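{- Let $j<k<l$ be positive integers and $p_j,p_k,p_l$ the corresponding primes. Then a positive integer $n$ coprime to $p_jp_kp_l$ can be written as $n=p_jp_kx+p_jp_ly+p_kp_lz$ with positive integers $x,y,z$ such that $(x,y,z)=1$ and $(p_j,z)=(p_k,y)=(p_l,x)=1$, provided one of the following holds: (1) $j\ge10$ and $n\ge(8p_1\cdots p_{j-6}+6)p_jp_kp_l$; (2) $j\in\{8,9\}$ and $n\ge(6p_1\cdots p_{j-5}+6)p_jp_kp_l$; (3) $j\in\{6,7\}$ and $n\ge(4p_1\cdots p_{j-4}+6)p_jp_kp_l$; (4) $j=5$ and $n\ge(3p_1p_2+6)p_jp_kp_l$; (5) $j=4$ and $n\ge(2p_1p_2+6)p_jp_kp_l$; (6) $j=3$ and $n\ge 6p_jp_kp_l$; (7) $j=2$ and $n\ge 4p_jp_kp_l$; (8) $j=1$ and $n\ge 3p_jp_kp_l$.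
   Context: $p_i$ denotes the $i$-th prime number in increasing order ($p_1=2,p_2=3,\ldots$). $(b_1,\ldots,b_k)$ denotes the greatest common divisor. -}

module Defs where

open import Data.Nat using (ℕ; zero; suc; _+_; _*_; _<_; _≤_; _!)
open import Data.Nat.Primality using (prime?)

open import Relation.Nullary.Decidable using (does)
open import Data.Bool using (if_then_else_)

-- firstPrimeFrom m fuel : the least prime among m, m+1, ..., m+fuel-1
-- (returns m + fuel if none is found; never happens when used below).
firstPrimeFrom : ℕ → ℕ → ℕ
firstPrimeFrom m zero = m
firstPrimeFrom m (suc fuel) =
  if does (prime? m) then m else firstPrimeFrom (suc m) fuel

-- nextPrime m : the least prime strictly greater than m.
-- The search range m+1 .. m+m! suffices (Euclid: some prime divisor of m!+1 exceeds m).
nextPrime : ℕ → ℕ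
nextPrime m = firstPrimeFrom (suc m) (m !)

-- p i : the i-th prime, 1-indexed (p 1 = 2, p 2 = 3, ...). p 0 is junk (= 2).
p : ℕ → ℕ
p zero = 2
p (suc zero) = 2
p (suc (suc i)) = nextPrime (p (suc i))

primorialUpTo : ℕ → ℕ
primorialUpTo zero = 1
primorialUpTo (suc m) = primorialUpTo m * p (suc m)

-- Write a = p j < b = p k < c = p l.  Pick z ∈ (0, a) with b c z ≡ n (mod a), and then, by the Chinese
-- remainder theorem, y < b z with a c y ≡ n (mod b) and y ≡ 1 (mod z).  Then S = a c y + b c z is
-- congruent to n modulo a and b and satisfies S < a²bc, so n − S = a b x with x ≥ 1 as soon as
-- n ≥ a · abc.  From a, b, c ∤ n and the congruences follow a ∤ z, b ∤ y and c ∤ x, and (y, z) = 1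
-- gives (x, y, z) = 1.  Each size condition therefore only has to bound p j by its coefficient.  For j ≥ 10
-- this holds because, with P = p 1 ⋯ p (j − 6), the numbers uP + 1 (u = 1, …, 6) have six pairwise
-- distinct prime divisors larger than p (j − 6) and at most 6P + 1, so p j ≤ 6P + 1; the cases
-- j ≤ 9 are finite computations.

module Submission where

open import Defs
open import Data.Nat
open import Data.Nat.Properties
open import Data.Nat.Divisibility
open import Data.Nat.DivMod
open import Data.Nat.Primality
open import Data.Nat.Primality.Factorisation using (factorise)
open import Data.Nat.ListAction using (product)
open import Data.Nat.GCD using (gcd; module Bézout; gcd[m,n]∣m; gcd[m,n]∣n)
open import Data.Nat.Coprimality as Coprimality using (Coprime; coprime-Bézout; coprime-divisor; prime⇒coprime)
open import Data.Nat.Tactic.RingSolver using (solve-∀)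
open import Data.List using ([]; _∷_)
open import Data.List.Relation.Unary.All using (_∷_)
open import Data.Fin using (Fin; zero; suc; punchIn; toℕ)
open import Data.Fin.Properties using (any?; punchIn-injective; punchInᵢ≢i; toℕ<n; toℕ-injective)
open import Data.Product using (_×_; _,_; ∃-syntax; uncurry; proj₁; proj₂)
open import Data.Sum using (_⊎_; inj₁; inj₂)
open import Data.Unit using (tt)
open import Function using (_∘_)
open import Function.Definitions using (Injective)
open import Relation.Binary.Definitions using (tri<; tri≈; tri>)
open import Relation.Nullary using (¬_; yes; no; contradiction)
open import Relation.Binary.PropositionalEquality

prime⇒2≤ : ∀ {q} → Prime q → 2 ≤ q
prime⇒2≤ {q} pq = nonTrivial⇒n>1 q {{prime⇒nonTrivial pq}}

primeDivisor : ∀ n → 2 ≤ n → ∃[ q ] Prime q × q ∣ n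
primeDivisor n@(suc _) 2≤n with factorise n
... | record { factors = [] ; isFactorisation = n≡1 } = contradiction n≡1 (>⇒≢ 2≤n)
... | record { factors = q ∷ qs ; isFactorisation = n≡q*qs ; factorsPrime = pq ∷ _ } =
  q , pq , subst (q ∣_) (sym n≡q*qs) (m∣m*n (product qs))

firstPrimeFrom-≥ : ∀ s f → s ≤ firstPrimeFrom s f
firstPrimeFrom-≥ s zero = ≤-refl
firstPrimeFrom-≥ s (suc f) with prime? s
... | yes _ = ≤-refl
... | no _ = ≤-trans (n≤1+n s) (firstPrimeFrom-≥ (suc s) f)

firstPrimeFrom-least : ∀ s f {q} → s ≤ q → q < firstPrimeFrom s f → ¬ Prime q
firstPrimeFrom-least s zero s≤q q<s = contradiction s≤q (<⇒≱ q<s)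
firstPrimeFrom-least s (suc f) s≤q q<r with prime? s | m≤n⇒m<n∨m≡n s≤q
... | yes _ | _ = contradiction s≤q (<⇒≱ q<r)
... | no _ | inj₁ s<q = firstPrimeFrom-least (suc s) f s<q q<r
... | no ¬ps | inj₂ refl = ¬ps

firstPrimeFrom-prime : ∀ s f {q} → Prime q → s ≤ q → q < s + f → Prime (firstPrimeFrom s f)
firstPrimeFrom-prime s zero {q} pq s≤q q<s+0 = contradiction s≤q (<⇒≱ (subst (q <_) (+-identityʳ s) q<s+0))
firstPrimeFrom-prime s (suc f) {q} pq s≤q q<s+1+f with prime? s | m≤n⇒m<n∨m≡n s≤q
... | yes ps | _ = ps
... | no _ | inj₁ s<q = firstPrimeFrom-prime (suc s) f pq s<q (subst (q <_) (+-suc s f) q<s+1+f)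
... | no ¬ps | inj₂ refl = contradiction pq ¬ps

nextPrime-> : ∀ m → m < nextPrime m
nextPrime-> m = firstPrimeFrom-≥ (suc m) (m !)

nextPrime-least : ∀ m {q} → m < q → q < nextPrime m → ¬ Prime q
nextPrime-least m = firstPrimeFrom-least (suc m) (m !)

n∣n! : ∀ n .{{_ : NonZero n}} → n ∣ n !
n∣n! (suc n) = m∣m*n (n !)

-- Euclid: a prime divisor q of 1 + m! exceeds m, since otherwise q ∣ m! and so q ∣ 1.
nextPrime-prime : ∀ m → 1 ≤ m → Prime (nextPrime m)
nextPrime-prime m 1≤m with primeDivisor (1 + m !) (s≤s (1≤n! m))
... | q , pq , q∣1+m! = firstPrimeFrom-prime (suc m) (m !) pq m<q (s≤s q≤m+m!)
  where
  instance _ = prime⇒nonZero pq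
  m<q : m < q
  m<q = ≰⇒> λ q≤m → nonTrivial⇒≢1 {{prime⇒nonTrivial pq}}
    (∣1⇒≡1 (∣m+n∣m⇒∣n (subst (q ∣_) (+-comm 1 (m !)) q∣1+m!) (∣-trans (n∣n! q) (m≤n⇒m!∣n! q≤m))))
  q≤m+m! : q ≤ m + m !
  q≤m+m! = ≤-trans (∣⇒≤ q∣1+m!) (+-monoˡ-≤ (m !) 1≤m)

p-prime : ∀ i → Prime (p i)
p-prime zero = prime[2]
p-prime (suc zero) = prime[2]
p-prime (suc (suc i)) = nextPrime-prime (p (suc i)) (≤-trans (s≤s z≤n) (prime⇒2≤ (p-prime (suc i))))

p-step : ∀ {i} → 1 ≤ i → p i < p (suc i)
p-step {suc i} _ = nextPrime-> (p (suc i))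

p-strict : ∀ {i j} → 1 ≤ i → i < j → p i < p j
p-strict 1≤i (s≤s i≤j) with m≤n⇒m<n∨m≡n i≤j
... | inj₁ i<j = <-trans (p-strict 1≤i i<j) (p-step (≤-trans 1≤i (<⇒≤ i<j)))
... | inj₂ refl = p-step 1≤i

p-next : ∀ i {q} → Prime q → p (suc i) < q → p (suc (suc i)) ≤ q
p-next i pq p<q = ≮⇒≥ λ q<p → nextPrime-least (p (suc i)) p<q q<p pq

prime≤p⇒∣primorial : ∀ i {q} → Prime q → q ≤ p (suc i) → q ∣ primorialUpTo (suc i)
prime≤p⇒∣primorial zero pq q≤2 rewrite ≤-antisym q≤2 (prime⇒2≤ pq) = ∣-refl
prime≤p⇒∣primorial (suc i) {q} pq q≤p with q ≤? p (suc i)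
... | yes q≤p′ = ∣m⇒∣m*n (p (suc (suc i))) (prime≤p⇒∣primorial i pq q≤p′)
... | no q≰p′ rewrite ≤-antisym q≤p (p-next i pq (≰⇒> q≰p′)) = n∣m*n (primorialUpTo (suc i))

distinctPrimesBetween⇒p≤ : ∀ k i {X} (f : Fin k → ℕ) → Injective _≡_ _≡_ f → (∀ r → Prime (f r)) →
  (∀ r → p (suc i) < f r) → (∀ r → f r ≤ X) → p (suc i) ≤ X → p (k + suc i) ≤ X
distinctPrimesBetween⇒p≤ zero i f _ _ _ _ p≤X = p≤X
distinctPrimesBetween⇒p≤ (suc k) i {X} f f-inj f-prime p<f f≤X _ = uncurry omitting hit
  where
  p′≤f : ∀ r → p (suc (suc i)) ≤ f r
  p′≤f r = p-next i (f-prime r) (p<f r)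
  hit : ∃[ r₀ ] ∀ r → f (punchIn r₀ r) ≢ p (suc (suc i))
  hit with any? (λ r → f r ≟ p (suc (suc i)))
  ... | yes (r₀ , fr₀≡p′) = r₀ , λ r fr≡p′ → punchInᵢ≢i r₀ r (f-inj (trans fr≡p′ (sym fr₀≡p′)))
  ... | no none = zero , λ r fr≡p′ → none (suc r , fr≡p′)
  omitting : (r₀ : Fin (suc k)) → (∀ r → f (punchIn r₀ r) ≢ p (suc (suc i))) → p (suc k + suc i) ≤ X
  omitting r₀ miss = subst (λ j → p j ≤ X) (+-suc k (suc i))
    (distinctPrimesBetween⇒p≤ k (suc i) (f ∘ punchIn r₀) (punchIn-injective r₀ _ _ ∘ f-inj) (f-prime ∘ punchIn r₀)
      (λ r → ≤∧≢⇒< (p′≤f (punchIn r₀ r)) (miss r ∘ sym)) (f≤X ∘ punchIn r₀) (≤-trans (p′≤f zero) (f≤X zero)))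

primorial-pos : ∀ i → 0 < primorialUpTo i
primorial-pos zero = s≤s z≤n
primorial-pos (suc i) = *-mono-≤ (primorial-pos i) (≤-trans (s≤s z≤n) (prime⇒2≤ (p-prime (suc i))))

prime∣u*primorial+1⇒p< : ∀ i u {q} → Prime q → q ∣ u * primorialUpTo (suc i) + 1 → p (suc i) < q
prime∣u*primorial+1⇒p< i u pq q∣uP+1 = ≰⇒> λ q≤p → nonTrivial⇒≢1 {{prime⇒nonTrivial pq}}
  (∣1⇒≡1 (∣m+n∣m⇒∣n q∣uP+1 (∣n⇒∣m*n u (prime≤p⇒∣primorial i pq q≤p))))

∣u*P+1∧∣[u+w]*P+1⇒∣w : ∀ {q} u w P → q ∣ u * P + 1 → q ∣ (u + w) * P + 1 → q ∣ w
∣u*P+1∧∣[u+w]*P+1⇒∣w {q} u w P q∣uP+1 q∣[u+w]P+1 =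
  ∣m+n∣m⇒∣n (subst (q ∣_) (expand u w P) (∣n⇒∣m*n (u + w) q∣uP+1)) (∣n⇒∣m*n u q∣[u+w]P+1)
  where
  expand : ∀ u w P → (u + w) * (u * P + 1) ≡ u * ((u + w) * P + 1) + w
  expand = solve-∀

-- The prime divisors of uP + 1 (1 ≤ u ≤ m, P the primorial) exceed p (i + 1) ≥ m - 1, and a common
-- divisor of uP + 1 and vP + 1 divides v - u, so these m primes are pairwise distinct.
p[m+i]≤m*primorial+1 : ∀ i m → 1 ≤ m → m ≤ suc (p (suc i)) → p (m + suc i) ≤ m * primorialUpTo (suc i) + 1
p[m+i]≤m*primorial+1 i m@(suc _) _ m≤1+p =
  distinctPrimesBetween⇒p≤ m i q q-injective (proj₁ ∘ proj₂ ∘ divisor) p<q q≤X (≤-trans (<⇒≤ (p<q zero)) (q≤X zero))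
  where
  P : ℕ
  P = primorialUpTo (suc i)
  N : Fin m → ℕ
  N r = suc (toℕ r) * P + 1
  divisor : ∀ r → ∃[ q ] Prime q × q ∣ N r
  divisor r = primeDivisor (N r) (+-monoˡ-≤ 1 (*-mono-≤ {1} {suc (toℕ r)} (s≤s z≤n) (primorial-pos (suc i))))
  q : Fin m → ℕ
  q r = proj₁ (divisor r)
  q∣N : ∀ r → q r ∣ N r
  q∣N r = proj₂ (proj₂ (divisor r))
  p<q : ∀ r → p (suc i) < q r
  p<q r = prime∣u*primorial+1⇒p< i (suc (toℕ r)) (proj₁ (proj₂ (divisor r))) (q∣N r)
  q≤X : ∀ r → q r ≤ m * P + 1
  q≤X r = ≤-trans (∣⇒≤ {{≢-nonZero (m+1+n≢0 _)}} (q∣N r)) (+-monoˡ-≤ 1 (*-monoˡ-≤ P (toℕ<n r)))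
  q-distinct : ∀ {r s} → toℕ r < toℕ s → q r ≢ q s
  q-distinct {r} {s} r<s qr≡qs = <⇒≱ (≤-<-trans (m∸n≤m (toℕ s) (toℕ r)) (toℕ<n s))
    (≤-trans m≤1+p (≤-trans (p<q r) (∣⇒≤ {{>-nonZero (m<n⇒0<n∸m r<s)}} q∣s-r)))
    where
    q∣s-r : q r ∣ toℕ s ∸ toℕ r
    q∣s-r = ∣u*P+1∧∣[u+w]*P+1⇒∣w (suc (toℕ r)) (toℕ s ∸ toℕ r) P (q∣N r)
      (subst (λ v → q r ∣ suc v * P + 1) (sym (m+[n∸m]≡n (<⇒≤ r<s))) (subst (_∣ N s) (sym qr≡qs) (q∣N s)))
  q-injective : Injective _≡_ _≡_ q
  q-injective {r} {s} qr≡qs with <-cmp (toℕ r) (toℕ s)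
  ... | tri< r<s _ _ = contradiction qr≡qs (q-distinct r<s)
  ... | tri≈ _ r≡s _ = toℕ-injective r≡s
  ... | tri> _ _ s<r = contradiction (sym qr≡qs) (q-distinct s<r)

∤⇒nonZero : ∀ {d m} → d ∤ m → NonZero m
∤⇒nonZero {d} {zero} d∤0 = contradiction (d ∣0) d∤0
∤⇒nonZero {m = suc _} _ = _

prime∧∤⇒coprime : ∀ {q m} → Prime q → q ∤ m → Coprime q m
prime∧∤⇒coprime pq q∤m (k∣q , k∣m) with prime⇒irreducible pq k∣q
... | inj₁ k≡1 = k≡1
... | inj₂ refl = contradiction k∣m q∤m

prime<prime⇒∤ : ∀ {q r} → Prime q → Prime r → q < r → q ∤ r
prime<prime⇒∤ pq pr q<r q∣r = nonTrivial⇒≢1 {{prime⇒nonTrivial pq}}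
  (prime⇒coprime pr {{prime⇒nonZero pq}} q<r (q∣r , ∣-refl))

prime∧∤∧∤⇒∤* : ∀ {q m n} → Prime q → q ∤ m → q ∤ n → q ∤ m * n
prime∧∤∧∤⇒∤* {m = m} {n} pq q∤m q∤n q∣mn with euclidsLemma m n pq q∣mn
... | inj₁ q∣m = q∤m q∣m
... | inj₂ q∣n = q∤n q∣n

coprime∧∣⇒∤ : ∀ {n M q} → Coprime n M → Prime q → q ∣ M → q ∤ n
coprime∧∣⇒∤ n⊥M pq q∣M q∣n = nonTrivial⇒≢1 {{prime⇒nonTrivial pq}} (n⊥M (q∣n , q∣M))

coprime⇒gcd[gcd[x,y],z]≡1 : ∀ x {y z} → Coprime y z → gcd (gcd x y) z ≡ 1
coprime⇒gcd[gcd[x,y],z]≡1 x {y} {z} y⊥z =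
  y⊥z (∣-trans (gcd[m,n]∣m (gcd x y) z) (gcd[m,n]∣n x y) , gcd[m,n]∣n (gcd x y) z)

coprime⇒∣∧∣⇒*∣ : ∀ {a b m} → Coprime a b → a ∣ m → b ∣ m → a * b ∣ m
coprime⇒∣∧∣⇒*∣ {a} {b} a⊥b (divides k refl) b∣ka
  with coprime-divisor (Coprimality.sym a⊥b) (subst (b ∣_) (*-comm k a) b∣ka)
... | divides l refl = divides l (trans (*-assoc l b a) (cong (l *_) (*-comm b a)))

infix 4 _≡_[mod_]
_≡_[mod_] : ℕ → ℕ → (d : ℕ) → .{{NonZero d}} → Set
m ≡ n [mod d ] = m % d ≡ n % d

module _ {d : ℕ} .{{_ : NonZero d}} where

  *-congˡ-mod : ∀ e {m n} → m ≡ n [mod d ] → e * m ≡ e * n [mod d ]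
  *-congˡ-mod e {m} {n} m≡n = begin
    (e * m) % d               ≡⟨ %-distribˡ-* e m d ⟩
    ((e % d) * (m % d)) % d   ≡⟨ cong (λ r → ((e % d) * r) % d) m≡n ⟩
    ((e % d) * (n % d)) % d   ≡⟨ %-distribˡ-* e n d ⟨
    (e * n) % d               ∎
    where open ≡-Reasoning

  +-congˡ-mod : ∀ k {m n} → m ≡ n [mod d ] → k + m ≡ k + n [mod d ]
  +-congˡ-mod k {m} {n} m≡n = begin
    (k + m) % d               ≡⟨ %-distribˡ-+ k m d ⟩
    ((k % d) + (m % d)) % d   ≡⟨ cong (λ r → ((k % d) + r) % d) m≡n ⟩
    ((k % d) + (n % d)) % d   ≡⟨ %-distribˡ-+ k n d ⟨
    (k + n) % d               ∎
    where open ≡-Reasoning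

  %-mod : ∀ m → m % d ≡ m [mod d ]
  %-mod m = m%n%n≡m%n m d

  congruent∧∤⇒∤ : ∀ e {m n} → e * m ≡ n [mod d ] → d ∤ n → d ∤ m
  congruent∧∤⇒∤ e {m} {n} em≡n d∤n d∣m =
    d∤n (m%n≡0⇒n∣m n d (trans (sym em≡n) (n∣m⇒m%n≡0 (e * m) d (∣n⇒∣m*n e d∣m))))

  congruent⇒∣∸ : ∀ {m n} → m ≤ n → m ≡ n [mod d ] → d ∣ n ∸ m
  congruent⇒∣∸ {m} {n} m≤n m≡n = divides (n / d ∸ m / d) (begin
    n ∸ m                                      ≡⟨ cong₂ _∸_ (m≡m%n+[m/n]*n n d) (trans (m≡m%n+[m/n]*n m d) (cong (_+ m / d * d) m≡n)) ⟩
    (n % d + n / d * d) ∸ (n % d + m / d * d) ≡⟨ [m+n]∸[m+o]≡n∸o (n % d) (n / d * d) (m / d * d) ⟩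
    n / d * d ∸ m / d * d                      ≡⟨ *-distribʳ-∸ d (n / d) (m / d) ⟨
    (n / d ∸ m / d) * d                        ∎)
    where open ≡-Reasoning

  -- 1 % d is 0 when d = 1; a divisor k of d and 1 % d still divides 1 = 1 % d + (1 / d) * d.
  congruent1⇒coprime : ∀ {m} → m ≡ 1 [mod d ] → Coprime m d
  congruent1⇒coprime {m} m≡1 {k} (k∣m , k∣d) = ∣1⇒≡1 (subst (k ∣_) (sym (m≡m%n+[m/n]*n 1 d))
    (∣m∣n⇒∣m+n (subst (k ∣_) m≡1 (%-presˡ-∣ k∣m k∣d)) (∣n⇒∣m*n (1 / d) k∣d)))

-- From Bézout's identity 1 + y a = x e, or 1 + x e = y a with inverse x (a - 1).
modularInverse : ∀ {e a} .{{_ : NonZero a}} → Coprime e a → ∃[ u ] e * u ≡ 1 [mod a ]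
modularInverse {e} {a} e⊥a with coprime-Bézout e⊥a
... | Bézout.+- x y 1+ya≡xe = x , (begin
  (e * x) % a       ≡⟨ cong (_% a) (*-comm e x) ⟩
  (x * e) % a       ≡⟨ cong (_% a) 1+ya≡xe ⟨
  (1 + y * a) % a   ≡⟨ [m+kn]%n≡m%n 1 y a ⟩
  1 % a             ∎)
  where open ≡-Reasoning
... | Bézout.-+ x y 1+xe≡ya = x * pred a , (begin
  (e * (x * pred a)) % a                ≡⟨ [m+kn]%n≡m%n (e * (x * pred a)) y a ⟨
  (e * (x * pred a) + y * a) % a        ≡⟨ cong (λ t → (e * (x * pred a) + t) % a) 1+xe≡ya ⟨
  (e * (x * pred a) + (1 + x * e)) % a  ≡⟨ cong (_% a) (regroup e x (pred a)) ⟩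
  (1 + e * x * suc (pred a)) % a        ≡⟨ cong (λ t → (1 + e * x * t) % a) (suc-pred a) ⟩
  (1 + e * x * a) % a                   ≡⟨ [m+kn]%n≡m%n 1 (e * x) a ⟩
  1 % a                                 ∎)
  where
  open ≡-Reasoning
  regroup : ∀ e x a′ → e * (x * a′) + (1 + x * e) ≡ 1 + e * x * suc a′
  regroup = solve-∀

linearCongruence : ∀ {e a} n .{{_ : NonZero a}} → Coprime e a → ∃[ z ] z < a × e * z ≡ n [mod a ]
linearCongruence {e} {a} n e⊥a with u , eu≡1 ← modularInverse e⊥a =
  (u * n) % a , m%n<n (u * n) a , (begin
  (e * ((u * n) % a)) % a   ≡⟨ *-congˡ-mod e (%-mod (u * n)) ⟩
  (e * (u * n)) % a         ≡⟨ cong (_% a) (trans (sym (*-assoc e u n)) (*-comm (e * u) n)) ⟩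
  (n * (e * u)) % a         ≡⟨ *-congˡ-mod n eu≡1 ⟩
  (n * 1) % a               ≡⟨ cong (_% a) (*-identityʳ n) ⟩
  n % a                     ∎)
  where open ≡-Reasoning

m<n∧o<p⇒m+o*n<p*n : ∀ {m n o p} → m < n → o < p → m + o * n < p * n
m<n∧o<p⇒m+o*n<p*n {m} {n} {o} {p} m<n o<p = begin-strict
  m + o * n   <⟨ +-monoˡ-< (o * n) m<n ⟩
  suc o * n   ≤⟨ *-monoˡ-≤ n o<p ⟩
  p * n       ∎
  where open ≤-Reasoning

-- The congruence t b ≡ 1 - y₀ (mod z), with 1 - y₀ written as 1 + y₀ (z - 1) to avoid truncated subtraction.
y₀+t*b≡1 : ∀ {z} .{{_ : NonZero z}} y₀ b t → b * t ≡ 1 + y₀ * pred z [mod z ] → y₀ + t * b ≡ 1 [mod z ]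
y₀+t*b≡1 {z@(suc z′)} y₀ b t bt≡ = begin
  (y₀ + t * b) % z             ≡⟨ cong (λ r → (y₀ + r) % z) (*-comm t b) ⟩
  (y₀ + b * t) % z             ≡⟨ +-congˡ-mod y₀ bt≡ ⟩
  (y₀ + (1 + y₀ * z′)) % z     ≡⟨ cong (_% z) (regroup y₀ z′) ⟩
  (1 + y₀ * z) % z             ≡⟨ [m+kn]%n≡m%n 1 y₀ z ⟩
  1 % z                        ∎
  where
  open ≡-Reasoning
  regroup : ∀ y₀ z′ → y₀ + (1 + y₀ * z′) ≡ 1 + y₀ * suc z′
  regroup = solve-∀

-- y = y₀ + t b keeps the residue of y₀ modulo b, and t is chosen so that y ≡ 1 (mod z).
solutionCoprimeTo : ∀ {e b z} n .{{_ : NonZero b}} .{{_ : NonZero z}} → Coprime e b → Coprime b z →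
  ∃[ y ] y < z * b × e * y ≡ n [mod b ] × Coprime y z
solutionCoprimeTo {e} {b} {z} n e⊥b b⊥z
  with y₀ , y₀<b , ey₀≡n ← linearCongruence n e⊥b
  with t , t<z , bt≡ ← linearCongruence (1 + y₀ * pred z) b⊥z
  = y₀ + t * b , m<n∧o<p⇒m+o*n<p*n y₀<b t<z , trans (*-congˡ-mod e ([m+kn]%n≡m%n y₀ t b)) ey₀≡n ,
    congruent1⇒coprime (y₀+t*b≡1 y₀ b t bt≡)

congruent⇒∃quotient : ∀ {a b S n} .{{_ : NonZero a}} .{{_ : NonZero b}} → Coprime a b → S < n →
  S ≡ n [mod a ] → S ≡ n [mod b ] → ∃[ x ] 0 < x × n ≡ a * b * x + S
congruent⇒∃quotient {a} {b} {S} {n} a⊥b S<n S≡n[a] S≡n[b] =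
  x , 0<x , trans (sym (m∸n+n≡m (<⇒≤ S<n))) (cong (_+ S) (sym abx≡n∸S))
  where
  instance _ = m*n≢0 a b
  ab∣n∸S : a * b ∣ n ∸ S
  ab∣n∸S = coprime⇒∣∧∣⇒*∣ a⊥b (congruent⇒∣∸ (<⇒≤ S<n) S≡n[a]) (congruent⇒∣∸ (<⇒≤ S<n) S≡n[b])
  x : ℕ
  x = (n ∸ S) / (a * b)
  abx≡n∸S : a * b * x ≡ n ∸ S
  abx≡n∸S = m*[n/m]≡n ab∣n∸S
  0<x : 0 < x
  0<x = n≢0⇒n>0 λ x≡0 → <⇒≢ (m<n⇒0<n∸m S<n) (sym (trans (sym abx≡n∸S) (trans (cong (a * b *_) x≡0) (*-zeroʳ (a * b)))))

a*c*y+b*c*z<a*[a*b*c] : ∀ {a b c y z} .{{_ : NonZero a}} .{{_ : NonZero c}} → y < z * b → z < a →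
  a * c * y + b * c * z < a * (a * b * c)
a*c*y+b*c*z<a*[a*b*c] {a} {b} {c} {y} {z} y<zb z<a = begin-strict
  a * c * y + b * c * z         <⟨ +-monoˡ-< (b * c * z) (*-monoʳ-< (a * c) {{m*n≢0 a c}} y<zb) ⟩
  a * c * (z * b) + b * c * z   ≡⟨ regroup a b c z ⟩
  b * c * (suc a * z)           ≤⟨ *-monoʳ-≤ (b * c) [1+a]*z≤a*a ⟩
  b * c * (a * a)               ≡⟨ rearrange a b c ⟩
  a * (a * b * c)               ∎
  where
  open ≤-Reasoning
  regroup : ∀ a b c z → a * c * (z * b) + b * c * z ≡ b * c * (suc a * z)
  regroup = solve-∀
  rearrange : ∀ a b c → b * c * (a * a) ≡ a * (a * b * c)
  rearrange = solve-∀
  [1+a]*z≤a*a : suc a * z ≤ a * a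
  [1+a]*z≤a*a = begin
    z + a * z     ≤⟨ +-monoˡ-≤ (a * z) (<⇒≤ z<a) ⟩
    a + a * z     ≡⟨ *-suc a z ⟨
    a * suc z     ≤⟨ *-monoʳ-≤ a z<a ⟩
    a * a         ∎

Representation : ℕ → ℕ → ℕ → ℕ → Set
Representation a b c n = ∃[ x ] ∃[ y ] ∃[ z ]
  (1 ≤ x × 1 ≤ y × 1 ≤ z ×
   n ≡ a * b * x + a * c * y + b * c * z ×
   gcd (gcd x y) z ≡ 1 ×
   Coprime a z × Coprime b y × Coprime c x)

module _ {a b c n : ℕ} (pa : Prime a) (pb : Prime b) (pc : Prime c) (a<b : a < b) (b<c : b < c)
         (n⊥abc : Coprime n (a * b * c)) (a²bc≤n : a * (a * b * c) ≤ n) where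

  private instance
    a≢0 : NonZero a
    a≢0 = prime⇒nonZero pa
    b≢0 : NonZero b
    b≢0 = prime⇒nonZero pb
    c≢0 : NonZero c
    c≢0 = prime⇒nonZero pc

  private
    a∤n : a ∤ n
    a∤n = coprime∧∣⇒∤ n⊥abc pa (∣m⇒∣m*n c (m∣m*n b))
    b∤n : b ∤ n
    b∤n = coprime∧∣⇒∤ n⊥abc pb (∣m⇒∣m*n c (n∣m*n a))
    c∤n : c ∤ n
    c∤n = coprime∧∣⇒∤ n⊥abc pc (n∣m*n (a * b))
    a∤b : a ∤ b
    a∤b = prime<prime⇒∤ pa pb a<b

    representationFrom : ∀ {z} → z < a → b * c * z ≡ n [mod a ] →
      ∃[ y ] y < z * b × a * c * y ≡ n [mod b ] × Coprime y z → Representation a b c n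
    representationFrom {z} z<a bcz≡n (y , y<zb , acy≡n , y⊥z) =
      withQuotient (congruent⇒∃quotient (prime∧∤⇒coprime pa a∤b) S<n S≡n[a] S≡n[b])
      where
      S : ℕ
      S = a * c * y + b * c * z
      a∤z : a ∤ z
      a∤z = congruent∧∤⇒∤ (b * c) bcz≡n a∤n
      b∤y : b ∤ y
      b∤y = congruent∧∤⇒∤ (a * c) acy≡n b∤n
      S<n : S < n
      S<n = <-≤-trans (a*c*y+b*c*z<a*[a*b*c] y<zb z<a) a²bc≤n
      S≡n[a] : S ≡ n [mod a ]
      S≡n[a] = trans (%-remove-+ˡ (b * c * z) (∣m⇒∣m*n y (m∣m*n c))) bcz≡n
      S≡n[b] : S ≡ n [mod b ]
      S≡n[b] = trans (%-remove-+ʳ (a * c * y) (∣m⇒∣m*n z (m∣m*n c))) acy≡n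
      c∣S : c ∣ S
      c∣S = ∣m∣n⇒∣m+n (∣m⇒∣m*n y (n∣m*n a)) (∣m⇒∣m*n z (n∣m*n b))
      withQuotient : ∃[ x ] 0 < x × n ≡ a * b * x + S → Representation a b c n
      withQuotient (x , 0<x , n≡abx+S) =
        x , y , z , 0<x , >-nonZero⁻¹ y {{∤⇒nonZero b∤y}} , >-nonZero⁻¹ z {{∤⇒nonZero a∤z}} ,
        trans n≡abx+S (sym (+-assoc (a * b * x) (a * c * y) (b * c * z))) ,
        coprime⇒gcd[gcd[x,y],z]≡1 x y⊥z ,
        prime∧∤⇒coprime pa a∤z , prime∧∤⇒coprime pb b∤y ,
        prime∧∤⇒coprime pc λ c∣x → c∤n (subst (c ∣_) (sym n≡abx+S) (∣m∣n⇒∣m+n (∣n⇒∣m*n (a * b) c∣x) c∣S))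

  representation : Representation a b c n
  representation = withResidue (linearCongruence n bc⊥a)
    where
    bc⊥a : Coprime (b * c) a
    bc⊥a = Coprimality.sym (prime∧∤⇒coprime pa (prime∧∤∧∤⇒∤* pa a∤b (prime<prime⇒∤ pa pc (<-trans a<b b<c))))
    ac⊥b : Coprime (a * c) b
    ac⊥b = Coprimality.sym (prime∧∤⇒coprime pb (prime∧∤∧∤⇒∤* pb (>⇒∤ a<b) (prime<prime⇒∤ pb pc b<c)))
    withResidue : ∃[ z ] z < a × b * c * z ≡ n [mod a ] → Representation a b c n
    withResidue (z , z<a , bcz≡n) =
      representationFrom z<a bcz≡n (solutionCoprimeTo n {{_}} {{z≢0}} ac⊥b (prime⇒coprime pb {{z≢0}} (<-trans z<a a<b)))
      where
      z≢0 : NonZero z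
      z≢0 = ∤⇒nonZero (congruent∧∤⇒∤ (b * c) bcz≡n a∤n)

SizeCondition : ℕ → ℕ → ℕ → Set
SizeCondition j N n =
    (10 ≤ j × (8 * primorialUpTo (j ∸ 6) + 6) * N ≤ n)
  ⊎ (((j ≡ 8) ⊎ (j ≡ 9)) × (6 * primorialUpTo (j ∸ 5) + 6) * N ≤ n)
  ⊎ (((j ≡ 6) ⊎ (j ≡ 7)) × (4 * primorialUpTo (j ∸ 4) + 6) * N ≤ n)
  ⊎ (j ≡ 5 × (3 * (p 1 * p 2) + 6) * N ≤ n)
  ⊎ (j ≡ 4 × (2 * (p 1 * p 2) + 6) * N ≤ n)
  ⊎ (j ≡ 3 × 6 * N ≤ n)
  ⊎ (j ≡ 2 × 4 * N ≤ n)
  ⊎ (j ≡ 1 × 3 * N ≤ n)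

5≤p : ∀ {i} → 3 ≤ i → 5 ≤ p i
5≤p 3≤i with m≤n⇒m<n∨m≡n 3≤i
... | inj₁ 3<i = <⇒≤ (p-strict (s≤s z≤n) 3<i)
... | inj₂ refl = ≤-refl

p≤8*primorial+6 : ∀ j → 10 ≤ j → p j ≤ 8 * primorialUpTo (j ∸ 6) + 6
p≤8*primorial+6 (suc (suc (suc (suc (suc (suc (suc i))))))) (s≤s (s≤s (s≤s (s≤s (s≤s (s≤s (s≤s 3≤i))))))) = begin
  p (6 + suc i)          ≤⟨ p[m+i]≤m*primorial+1 i 6 (s≤s z≤n) (s≤s (5≤p (s≤s (≤-trans (s≤s (s≤s z≤n)) 3≤i)))) ⟩
  6 * P + 1              ≤⟨ +-mono-≤ (*-monoˡ-≤ P (m≤m+n 6 2)) (s≤s z≤n) ⟩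
  8 * P + 6              ∎
  where
  open ≤-Reasoning
  P : ℕ
  P = primorialUpTo (suc i)

p≤C⇒p*N≤ : ∀ j C N {n} → p j ≤ C → C * N ≤ n → p j * N ≤ n
p≤C⇒p*N≤ j C N pj≤C = ≤-trans (*-monoˡ-≤ N pj≤C)

sizeCondition⇒p*N≤ : ∀ j {N n} → SizeCondition j N n → p j * N ≤ n
sizeCondition⇒p*N≤ j {N} (inj₁ (10≤j , h)) = p≤C⇒p*N≤ j _ N (p≤8*primorial+6 j 10≤j) h
sizeCondition⇒p*N≤ _ {N} (inj₂ (inj₁ (inj₁ refl , h))) = p≤C⇒p*N≤ 8 (6 * primorialUpTo 3 + 6) N (≤ᵇ⇒≤ _ _ tt) h
sizeCondition⇒p*N≤ _ {N} (inj₂ (inj₁ (inj₂ refl , h))) = p≤C⇒p*N≤ 9 (6 * primorialUpTo 4 + 6) N (≤ᵇ⇒≤ _ _ tt) h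
sizeCondition⇒p*N≤ _ {N} (inj₂ (inj₂ (inj₁ (inj₁ refl , h)))) = p≤C⇒p*N≤ 6 (4 * primorialUpTo 2 + 6) N (≤ᵇ⇒≤ _ _ tt) h
sizeCondition⇒p*N≤ _ {N} (inj₂ (inj₂ (inj₁ (inj₂ refl , h)))) = p≤C⇒p*N≤ 7 (4 * primorialUpTo 3 + 6) N (≤ᵇ⇒≤ _ _ tt) h
sizeCondition⇒p*N≤ _ {N} (inj₂ (inj₂ (inj₂ (inj₁ (refl , h))))) = p≤C⇒p*N≤ 5 (3 * (p 1 * p 2) + 6) N (≤ᵇ⇒≤ _ _ tt) h
sizeCondition⇒p*N≤ _ {N} (inj₂ (inj₂ (inj₂ (inj₂ (inj₁ (refl , h)))))) = p≤C⇒p*N≤ 4 (2 * (p 1 * p 2) + 6) N (≤ᵇ⇒≤ _ _ tt) h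
sizeCondition⇒p*N≤ _ {N} (inj₂ (inj₂ (inj₂ (inj₂ (inj₂ (inj₁ (refl , h))))))) = p≤C⇒p*N≤ 3 6 N (≤ᵇ⇒≤ _ _ tt) h
sizeCondition⇒p*N≤ _ {N} (inj₂ (inj₂ (inj₂ (inj₂ (inj₂ (inj₂ (inj₁ (refl , h)))))))) = p≤C⇒p*N≤ 2 4 N (≤ᵇ⇒≤ _ _ tt) h
sizeCondition⇒p*N≤ _ {N} (inj₂ (inj₂ (inj₂ (inj₂ (inj₂ (inj₂ (inj₂ (refl , h)))))))) = p≤C⇒p*N≤ 1 3 N (≤ᵇ⇒≤ _ _ tt) h

mainTheorem9 : (j k l : ℕ) → 1 ≤ j → j < k → k < l →
    (n : ℕ) → 1 ≤ n → Coprime n (p j * p k * p l) →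
    ((10 ≤ j × (8 * primorialUpTo (j ∸ 6) + 6) * (p j * p k * p l) ≤ n)
     ⊎ (((j ≡ 8) ⊎ (j ≡ 9)) × (6 * primorialUpTo (j ∸ 5) + 6) * (p j * p k * p l) ≤ n)
     ⊎ (((j ≡ 6) ⊎ (j ≡ 7)) × (4 * primorialUpTo (j ∸ 4) + 6) * (p j * p k * p l) ≤ n)
     ⊎ (j ≡ 5 × (3 * (p 1 * p 2) + 6) * (p j * p k * p l) ≤ n)
     ⊎ (j ≡ 4 × (2 * (p 1 * p 2) + 6) * (p j * p k * p l) ≤ n)
     ⊎ (j ≡ 3 × 6 * (p j * p k * p l) ≤ n)
     ⊎ (j ≡ 2 × 4 * (p j * p k * p l) ≤ n)
     ⊎ (j ≡ 1 × 3 * (p j * p k * p l) ≤ n)) →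
    ∃[ x ] ∃[ y ] ∃[ z ]
      (1 ≤ x × 1 ≤ y × 1 ≤ z ×
       n ≡ p j * p k * x + p j * p l * y + p k * p l * z ×
       gcd (gcd x y) z ≡ 1 ×
       Coprime (p j) z × Coprime (p k) y × Coprime (p l) x)
-- The hypothesis 1 ≤ n is implied by the size condition.
mainTheorem9 j k l 1≤j j<k k<l n _ n⊥pjpkpl size =
  representation (p-prime j) (p-prime k) (p-prime l) (p-strict 1≤j j<k) (p-strict 1≤k k<l)
    n⊥pjpkpl (sizeCondition⇒p*N≤ j size)
  where
  1≤k : 1 ≤ k
  1≤k = ≤-trans 1≤j (<⇒≤ j<k)
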